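{- Let $n$ be a positive integer and let $\Gamma$ be either $C_\infty\cdot\overline{K_n}$ or $C_\infty\cdot K_n$. Let $\phi$ be a reduced coloring of $\Gamma$ and $\psi$ any splitting of $\phi$. If all vertices of block $V_i$ have $\phi$-color $a$ and all vertices of block $V_j$ have $\phi$-color $b$ with $a\ne b$, then the sets of colors $\psi(V_i)$ and $\psi(V_j)$ are disjoint.
   Context: $\Gamma$ has vertices $v_{ij}$, $i\in\mathbb Z$, $1\le j\le n$; in $C_\infty\cdot\overline{K_n}$, $v_{ij}\sim v_{i'j'}$ iff $|i-i'|=1$; in $C_\infty\cdot K_n$ additionally $v_{ij}\sim v_{ij'}$ for $j\ne j'$. Block $V_i=\{v_{i1},\dots,v_{in}\}$. A coloring with finitely many colors is perfect if every vertex of color $a$ has exactly $m_{ab}$ neighbours of color $b$ for a fixed matrix $(m_{ab})$. For a perfect coloring $\psi$ of $\Gamma$, two colors are equivalent if identifying them yields a perfect coloring (an equivalence relation); the coloring $\phi$ obtained by identifying colors within each class is a reduced coloring and $\psi$ is a splitting of $\phi$. -}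

module Defs where

open import Data.Nat using (ℕ; suc)
open import Data.Integer as ℤ using (ℤ; +_; -[1+_])
import Data.Integer.Properties as ℤP
open import Data.Fin using (Fin)
open import Data.Fin.Properties as FinP using (_≟_)
open import Data.List using (List; _∷_; []; concatMap; map; filter; length; allFin)
open import Data.Product using (_×_; _,_; Σ; ∃)
open import Data.Sum using (_⊎_)
open import Data.Bool using (Bool; true; false)
open import Relation.Nullary using (¬_; Dec; yes; no)
open import Relation.Nullary.Decidable using (_×-dec_; _⊎-dec_; ¬?)
open import Relation.Binary.PropositionalEquality using (_≡_)
open import Function using (_∘_; _⇔_)
open import Function.Definitions using (Surjective)

-- Which graph: C∞·K̄ₙ (complete = false) or C∞·Kₙ (complete = true).
-- Vertex v_{ij} is represented by the pair (i , j) with i : ℤ, j : Fin n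
-- (Fin n = {0,…,n-1} indexes 1 ≤ j ≤ n).
Vertex : ℕ → Set
Vertex n = ℤ × Fin n

IsComplete : Bool → Set
IsComplete b = b ≡ true

Adj : ∀ {n} → Bool → Vertex n → Vertex n → Set
Adj t (i , j) (i' , j') =
  ((i' ≡ i ℤ.+ + 1) ⊎ (i ≡ i' ℤ.+ + 1)) ⊎ (IsComplete t × (i ≡ i' × ¬ (j ≡ j')))

adj? : ∀ {n} (t : Bool) (v w : Vertex n) → Dec (Adj t v w)
adj? t (i , j) (i' , j') =
  ((i' ℤP.≟ (i ℤ.+ + 1)) ⊎-dec (i ℤP.≟ (i' ℤ.+ + 1)))
  ⊎-dec ((t Data.Bool.≟ true) ×-dec ((i ℤP.≟ i') ×-dec ¬? (j ≟ j')))

-- Every neighbour of (i , j) lies in blocks i-1, i, i+1; this finite list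
-- (without repetitions) contains them all.
window : ∀ {n} → Vertex n → List (Vertex n)
window {n} (i , _) =
  concatMap (λ d → map (λ j' → (i ℤ.+ d , j')) (allFin n))
            (ℤ.- + 1 ∷ + 0 ∷ + 1 ∷ [])

nbrCount : ∀ {n k} → Bool → (Vertex n → Fin k) → Vertex n → Fin k → ℕ
nbrCount t χ v b = length (filter (λ w → adj? t v w ×-dec (χ w ≟ b)) (window v))

Perfect : ∀ {n k} → Bool → (Vertex n → Fin k) → Set
Perfect {k = k} t χ =
  Σ (Fin k → Fin k → ℕ) λ m → ∀ v b → nbrCount t χ v b ≡ m (χ v) b

merge : ∀ {k} → Fin k → Fin k → Fin k → Fin k
merge c d x with x ≟ d
... | yes _ = c
... | no  _ = x

EquivColors : ∀ {n k} → Bool → (Vertex n → Fin k) → Fin k → Fin k → Set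
EquivColors t ψ c d = Perfect t (merge c d ∘ ψ)

-- ψ is a splitting of φ (and φ is the reduced coloring of ψ): ψ is a perfect
-- coloring with exactly the colors Fin k (all used), and φ = q ∘ ψ where the
-- fibres of q : Fin k → Fin l are exactly the equivalence classes of colors.
IsSplitting : ∀ {n k l} → Bool → (ψ : Vertex n → Fin k) → (φ : Vertex n → Fin l) → Set
IsSplitting {k = k} {l = l} t ψ φ =
  Perfect t ψ × Surjective _≡_ _≡_ ψ ×
  Σ (Fin k → Fin l) λ q →
    Surjective _≡_ _≡_ q ×
    (∀ c d → (q c ≡ q d) ⇔ EquivColors t ψ c d) ×
    (∀ v → φ v ≡ q (ψ v))

module Submission where

open import Defs
open import Data.Nat using (ℕ; suc)
open import Data.Integer using (ℤ)
open import Data.Fin using (Fin)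
open import Data.Bool using (Bool)
open import Data.Product using (_,_)
open import Relation.Nullary using (¬_)
open import Relation.Binary.PropositionalEquality using (_≡_; cong; module ≡-Reasoning)

factors-respects-≡ : ∀ {V A B : Set} {φ : V → A} {ψ : V → B} (q : B → A)
                   → (∀ v → φ v ≡ q (ψ v))
                   → ∀ {v w} → ψ v ≡ ψ w → φ v ≡ φ w
factors-respects-≡ {φ = φ} {ψ} q φ≡q∘ψ {v} {w} ψv≡ψw = begin
  φ v      ≡⟨ φ≡q∘ψ v ⟩
  q (ψ v)  ≡⟨ cong q ψv≡ψw ⟩
  q (ψ w)  ≡⟨ φ≡q∘ψ w ⟨
  φ w      ∎
  where open ≡-Reasoning

lemma5 : (n : ℕ) → (t : Bool) → {k l : ℕ}
    → (φ : Vertex (suc n) → Fin l) → (ψ : Vertex (suc n) → Fin k)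
    → IsSplitting t ψ φ
    → (i j : ℤ) → (a b : Fin l)
    → (∀ x → φ (i , x) ≡ a) → (∀ y → φ (j , y) ≡ b) → ¬ (a ≡ b)
    → ∀ x y → ¬ (ψ (i , x) ≡ ψ (j , y))
lemma5 n t φ ψ (_ , _ , q , _ , _ , φ≡q∘ψ) i j a b φVᵢ≡a φVⱼ≡b a≢b x y ψ-equal =
  a≢b (begin
    a            ≡⟨ φVᵢ≡a x ⟨
    φ (i , x)    ≡⟨ factors-respects-≡ q φ≡q∘ψ ψ-equal ⟩
    φ (j , y)    ≡⟨ φVⱼ≡b y ⟩
    b            ∎)
  where open ≡-Reasoning
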